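{- For every integer $n \ge 1$, the number $h(n)$ of self-half-conjugate overpartitions of $n$ in which only even parts may be overlined equals $q(n)$, the number of partitions of $n$ into distinct parts.
   Context: An overpartition of $n$ is a partition of $n$ in which the first occurrence of each distinct part value may be overlined; it may be viewed as a pair $(\mu,\nu)$ where $\mu$ is the partition formed by the non-overlined parts and $\nu$ is the partition into distinct parts formed by the overlined parts, with $|\mu|+|\nu|=n$. Let $D_2(n)$ be the set of overpartitions of $n$ in which every overlined part is even (so $\nu$ consists of distinct even parts). The half-conjugate of an overpartition $(\mu,\nu)$ is the overpartition $(\mu',\nu)$, where $\mu'$ is the conjugate of the partition $\mu$ (overlined parts are kept fixed and the partition of non-overlined parts is conjugated). An overpartition is self-half-conjugate if it equals its half-conjugate, i.e. $\mu = \mu'$. $h(n)$ is the number of self-half-conjugate elements of $D_2(n)$. -}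

module Defs where

open import Data.Nat using (ℕ; zero; suc; _+_; _*_; _∸_; _≤?_; _<?_)
open import Data.Nat.Properties using (_≟_)
open import Data.List using (List; []; _∷_; [_]; map; concatMap; filter; length; sum; upTo; applyUpTo)
open import Data.List.Properties using (≡-dec)
open import Relation.Nullary.Decidable using (does)
open import Data.Product using (_×_; _,_)
open import Data.Nat.DivMod using (_%_)

-- A partition is represented as a weakly decreasing list of positive naturals
-- (largest part first).  ν-type partitions (distinct parts) are strictly
-- decreasing lists of positive naturals.

1to : ℕ → List ℕ
1to n = applyUpTo suc n

-- partsFuel f n m : all partitions of n with every part ≤ m
-- (as weakly decreasing lists); fuel f ≥ n suffices.
partsFuel : ℕ → ℕ → ℕ → List (List ℕ)
partsFuel _ zero m = [ [] ]
partsFuel zero (suc n) m = []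
partsFuel (suc f) (suc n) m =
  concatMap (λ k → map (k ∷_) (partsFuel f (suc n ∸ k) k))
            (filter (λ k → k ≤? m) (1to (suc n)))

partitions : ℕ → List (List ℕ)
partitions n = partsFuel n n n

-- distFuel f n m : all partitions of n into distinct parts, every part < m
-- (as strictly decreasing lists); fuel f ≥ n suffices.
distFuel : ℕ → ℕ → ℕ → List (List ℕ)
distFuel _ zero m = [ [] ]
distFuel zero (suc n) m = []
distFuel (suc f) (suc n) m =
  concatMap (λ k → map (k ∷_) (distFuel f (suc n ∸ k) k))
            (filter (λ k → k <? m) (1to (suc n)))

distinctPartitions : ℕ → List (List ℕ)
distinctPartitions n = distFuel n n (suc n)

distinctEvenPartitions : ℕ → List (List ℕ)
distinctEvenPartitions n = filter (λ ν → length (filter (λ p → p % 2 ≟ 0) ν) ≟ length ν) (distinctPartitions n)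

conjugate : List ℕ → List ℕ
conjugate [] = []
conjugate (a ∷ λs) = map (λ j → length (filter (λ p → j ≤? p) (a ∷ λs))) (1to a)

q : ℕ → ℕ
q n = length (distinctPartitions n)

-- D₂(n) is the set of pairs (μ , ν), μ a partition, ν a partition into distinct
-- even parts, |μ| + |ν| = n.  The self-half-conjugate ones are those with μ = μ'.
selfHalfConjugateD₂ : ℕ → List (List ℕ × List ℕ)
selfHalfConjugateD₂ n =
  concatMap (λ a → concatMap (λ μ → map (μ ,_) (distinctEvenPartitions (n ∸ a)))
                             (filter (λ μ → ≡-dec _≟_ (conjugate μ) μ) (partitions a)))
            (upTo (suc n))

h : ℕ → ℕ
h n = length (selfHalfConjugateD₂ n)

-- A self-conjugate partition μ is the union of its nested diagonal hooks, whose lengths 2(μᵢ − i) + 1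
-- are distinct odd numbers summing to |μ|, and every set of distinct odd numbers arises in this way.
-- Hence (μ, ν) ↦ hooks(μ) ∪ ν maps the self-half-conjugate elements of D₂(n) bijectively onto the
-- partitions of n into distinct parts; the inverse splits such a partition into its odd and even parts.

module Submission where

open import Defs
open import Data.Nat
  using (ℕ; zero; suc; _+_; _∸_; _≤_; _<_; _>_; z≤n; s≤s; s≤s⁻¹; _≤?_; _<?_; _>?_; _≤ᵇ_; ⌊_/2⌋)
open import Data.Nat.Properties
  using (_≟_; <-≤-trans; <⇒≤; <-asym; ≤∧≢⇒<; +-assoc; +-comm; +-mono-<; +-mono-≤; ≮⇒≥; +-identityʳ
  ; ≤-refl; ≤-trans; ≤-reflexive; ≤-<-trans; <⇒≱; ≤-antisym; +-suc; <⇒≢; suc-injective; m∸n≤m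
  ; m+[n∸m]≡n; m+n∸m≡n; m≤m+n; m≤n+m)
open import Data.List
  using (List; []; _∷_; _++_; [_]; upTo; length; map; concatMap; filter; applyUpTo; replicate; merge)
open import Data.List.Properties
  using (≡-dec; length-++; length-map; length-replicate; length-applyUpTo; map-applyUpTo
  ; concatMap-cong; ∷-injectiveʳ; filter-accept; filter-reject; filter-all; filter-none
  ; filter-complete; ∷-injectiveˡ)
open import Data.List.Membership.Propositional using (_∈_; find; lose)
open import Data.List.Membership.Propositional.Properties
open import Data.List.Relation.Unary.All using (All; []; _∷_)
import Data.List.Relation.Unary.All as All
import Data.List.Relation.Unary.All.Properties as All
open import Data.List.Relation.Unary.AllPairs using ([]; _∷_)
open import Data.List.Relation.Unary.Any using (here; there)
open import Data.List.Relation.Unary.Unique.Propositional using (Unique)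
open import Data.List.Relation.Unary.Unique.Propositional.Properties
  using (map⁺; ++⁺; filter⁺; applyUpTo⁺₁; upTo⁺)
open import Data.Nat.DivMod using (_%_)
open import Data.Nat.ListAction using (sum)
open import Data.Nat.ListAction.Properties using (sum-++; sum-↭)
open import Data.List.Relation.Binary.Permutation.Propositional.Properties using (merge-↭)
open import Data.Bool using (true; false; if_then_else_)
open import Data.Product using (_×_; _,_; proj₁; proj₂)
open import Data.Sum using (inj₁; inj₂)
open import Data.Empty using (⊥; ⊥-elim)
open import Function using (_∘_)
open import Induction.WellFounded using (Acc; acc)
open import Data.Nat.Induction using (<-wellFounded)
open import Level using (0ℓ)
open import Relation.Binary using (Rel; Decidable)
open import Relation.Binary.PropositionalEquality hiding ([_])
open ≡-Reasoning
open import Relation.Nullary using (¬_; Dec; yes; no; does)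
open import Relation.Unary using (Pred; ∁)
import Relation.Unary as U
open import Relation.Unary.Properties using (∁?)

length-≤-by-injection : ∀ {A B : Set} {xs : List A} {ys : List B} → Unique xs → (f : A → B) →
  (∀ {a b} → a ∈ xs → b ∈ xs → f a ≡ f b → a ≡ b) →
  (∀ {x} → x ∈ xs → f x ∈ ys) → length xs ≤ length ys
length-≤-by-injection {xs = []} _ f inj into = z≤n
length-≤-by-injection {xs = x ∷ xs} {ys} (x∉xs ∷ u) f inj into
  with us , vs , refl ← ∈-∃++ (into (here refl)) =
  ≤-trans (s≤s (length-≤-by-injection u f (λ a b → inj (there a) (there b)) into′))
          (≤-reflexive (sym (length-++-∷ us)))
  where
    length-++-∷ : ∀ us → length (us ++ f x ∷ vs) ≡ suc (length (us ++ vs))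
    length-++-∷ [] = refl
    length-++-∷ (_ ∷ us) = cong suc (length-++-∷ us)
    into′ : ∀ {z} → z ∈ xs → f z ∈ us ++ vs
    into′ {z} z∈xs with ∈-++⁻ us (into (there z∈xs))
    ... | inj₁ p = ∈-++⁺ˡ p
    ... | inj₂ (here fz≡fx) = ⊥-elim (All.lookup x∉xs z∈xs (sym (inj (there z∈xs) (here refl) fz≡fx)))
    ... | inj₂ (there p) = ∈-++⁺ʳ us p

length-≡-by-inverses : ∀ {A B : Set} {xs : List A} {ys : List B} → Unique xs → Unique ys →
  (f : A → B) (g : B → A) →
  (∀ {x} → x ∈ xs → f x ∈ ys) → (∀ {y} → y ∈ ys → g y ∈ xs) →
  (∀ {x} → x ∈ xs → g (f x) ≡ x) → (∀ {y} → y ∈ ys → f (g y) ≡ y) →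
  length xs ≡ length ys
length-≡-by-inverses uxs uys f g f∈ g∈ gf fg = ≤-antisym
  (length-≤-by-injection uxs f (λ a b e → trans (sym (gf a)) (trans (cong g e) (gf b))) f∈)
  (length-≤-by-injection uys g (λ a b e → trans (sym (fg a)) (trans (cong f e) (fg b))) g∈)

concatMap-unique : ∀ {A B : Set} {xs : List A} {g : A → List B} (tag : B → A) →
  Unique xs → (∀ x → Unique (g x)) → (∀ {x z} → x ∈ xs → z ∈ g x → tag z ≡ x) →
  Unique (concatMap g xs)
concatMap-unique {xs = []} tag _ _ _ = []
concatMap-unique {xs = x ∷ xs} {g} tag (x∉xs ∷ u) ug tagged =
  ++⁺ (ug x) (concatMap-unique tag u ug (tagged ∘ there)) disjoint
  where
    disjoint : ∀ {z} → z ∈ g x × z ∈ concatMap g xs → ⊥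
    disjoint (z∈gx , z∈rest) with x′ , x′∈xs , z∈gx′ ← find (∈-concatMap⁻ g {xs = xs} z∈rest) =
      All.lookup x∉xs x′∈xs (trans (sym (tagged (here refl) z∈gx)) (tagged (there x′∈xs) z∈gx′))

data Descending (R : Rel ℕ 0ℓ) : ℕ → List ℕ → Set where
  [] : ∀ {m} → Descending R m []
  cons : ∀ {m k xs} → 1 ≤ k → R k m → Descending R k xs → Descending R m (k ∷ xs)

Partition : ℕ → List ℕ → Set
Partition = Descending _≤_

Distinct : ℕ → List ℕ → Set
Distinct = Descending _<_

descending : {R : Rel ℕ 0ℓ} → Decidable R → (fuel n m : ℕ) → List (List ℕ)
descending R? _ zero m = [ [] ]
descending R? zero (suc n) m = []
descending R? (suc f) (suc n) m =
  concatMap (λ k → map (k ∷_) (descending R? f (suc n ∸ k) k))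
            (filter (λ k → R? k m) (1to (suc n)))

partsFuel≡descending : ∀ f n m → partsFuel f n m ≡ descending _≤?_ f n m
partsFuel≡descending f zero m = refl
partsFuel≡descending zero (suc n) m = refl
partsFuel≡descending (suc f) (suc n) m =
  concatMap-cong (λ k → cong (map (k ∷_)) (partsFuel≡descending f (suc n ∸ k) k))
                 (filter (λ k → k ≤? m) (1to (suc n)))

distFuel≡descending : ∀ f n m → distFuel f n m ≡ descending _<?_ f n m
distFuel≡descending f zero m = refl
distFuel≡descending zero (suc n) m = refl
distFuel≡descending (suc f) (suc n) m =
  concatMap-cong (λ k → cong (map (k ∷_)) (distFuel≡descending f (suc n ∸ k) k))
                 (filter (λ k → k <? m) (1to (suc n)))

module _ {R : Rel ℕ 0ℓ} (R? : Decidable R) where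

  descending-unique : ∀ f n m → Unique (descending R? f n m)
  descending-unique f zero m = [] ∷ []
  descending-unique zero (suc n) m = []
  descending-unique (suc f) (suc n) m =
    concatMap-unique head (filter⁺ (λ k → R? k m) (applyUpTo⁺₁ suc (suc n) (λ i<j _ → <⇒≢ i<j ∘ suc-injective)))
      (λ k → map⁺ ∷-injectiveʳ (descending-unique f (suc n ∸ k) k))
      head-∈-map-∷
    where
      head : List ℕ → ℕ
      head [] = 0
      head (k ∷ _) = k
      head-∈-map-∷ : ∀ {k zs} → k ∈ filter (λ k → R? k m) (1to (suc n)) →
        zs ∈ map (k ∷_) (descending R? f (suc n ∸ k) k) → head zs ≡ k
      head-∈-map-∷ {k} _ zs∈ with _ , _ , refl ← ∈-map⁻ (k ∷_) zs∈ = refl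

  ∈-descending⁻ : ∀ {f n m xs} → xs ∈ descending R? f n m → Descending R m xs × sum xs ≡ n
  ∈-descending⁻ {f} {zero} (here refl) = [] , refl
  ∈-descending⁻ {zero} {suc n} ()
  ∈-descending⁻ {suc f} {suc n} {m} xs∈
    with k , k∈ , xs∈k ← find (∈-concatMap⁻ (λ k → map (k ∷_) (descending R? f (suc n ∸ k) k))
                                              {xs = filter (λ k → R? k m) (1to (suc n))} xs∈)
    with k∈1to , kRm ← ∈-filter⁻ (λ k → R? k m) {xs = 1to (suc n)} k∈
    with ys , ys∈ , refl ← ∈-map⁻ (k ∷_) xs∈k
    with i , i<1+n , refl ← ∈-applyUpTo⁻ suc k∈1to
    with desc , sum≡ ← ∈-descending⁻ ys∈ =
    cons (s≤s z≤n) kRm desc , trans (cong (suc i +_) sum≡) (m+[n∸m]≡n i<1+n)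

  ∈-descending⁺ : ∀ {f n m xs} → n ≤ f → Descending R m xs → sum xs ≡ n → xs ∈ descending R? f n m
  ∈-descending⁺ {n = zero} {xs = []} _ _ _ = here refl
  ∈-descending⁺ {n = zero} {xs = suc _ ∷ _} _ _ ()
  ∈-descending⁺ {xs = zero ∷ _} _ (cons () _ _) _
  ∈-descending⁺ {suc f} {suc n} {m} {suc i ∷ xs} (s≤s n≤f) (cons _ kRm desc) sum≡ =
    ∈-concatMap⁺ (λ k → map (k ∷_) (descending R? f (suc n ∸ k) k))
      (lose (∈-filter⁺ (λ k → R? k m) (∈-applyUpTo⁺ suc i<1+n) kRm)
            (∈-map⁺ (suc i ∷_) (∈-descending⁺ (≤-trans (m∸n≤m n i) n≤f) desc sum-xs≡)))
    where
      sum-xs≡ : sum xs ≡ n ∸ i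
      sum-xs≡ = trans (sym (m+n∸m≡n i (sum xs))) (cong (_∸ i) (suc-injective sum≡))
      i<1+n : i < suc n
      i<1+n = s≤s (subst (i ≤_) (suc-injective sum≡) (m≤m+n i (sum xs)))

count : ℕ → List ℕ → ℕ
count j xs = length (filter (j ≤?_) xs)

count-accept : ∀ {j x} xs → j ≤ x → count j (x ∷ xs) ≡ suc (count j xs)
count-accept xs j≤x = cong length (filter-accept (_ ≤?_) j≤x)

count-reject : ∀ {j x} xs → ¬ j ≤ x → count j (x ∷ xs) ≡ count j xs
count-reject xs j≰x = cong length (filter-reject (_ ≤?_) j≰x)

count-zero : ∀ xs → count 0 xs ≡ length xs
count-zero [] = refl
count-zero (x ∷ xs) = trans (count-accept {x = x} xs z≤n) (cong suc (count-zero xs))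

count-map-suc : ∀ j xs → count (suc j) (map suc xs) ≡ count j xs
count-map-suc j [] = refl
count-map-suc j (x ∷ xs) with j ≤? x
... | yes j≤x = trans (count-accept (map suc xs) (s≤s j≤x))
                      (trans (cong suc (count-map-suc j xs)) (sym (count-accept xs j≤x)))
... | no j≰x = trans (count-reject (map suc xs) (j≰x ∘ s≤s⁻¹))
                     (trans (count-map-suc j xs) (sym (count-reject xs j≰x)))

count-++-zeros : ∀ j xs r → count (suc j) (xs ++ replicate r 0) ≡ count (suc j) xs
count-++-zeros j [] zero = refl
count-++-zeros j [] (suc r) = count-++-zeros j [] r
count-++-zeros j (x ∷ xs) r with suc j ≤? x
... | yes j<x = trans (count-accept (xs ++ _) j<x)
                      (trans (cong suc (count-++-zeros j xs r)) (sym (count-accept xs j<x)))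
... | no j≮x = trans (count-reject (xs ++ _) j≮x)
                     (trans (count-++-zeros j xs r) (sym (count-reject xs j≮x)))

count-Partition-1 : ∀ {m xs} → Partition m xs → count 1 xs ≡ length xs
count-Partition-1 [] = refl
count-Partition-1 {xs = x ∷ xs} (cons 1≤x _ p) = trans (count-accept xs 1≤x) (cong suc (count-Partition-1 p))

count-Partition-> : ∀ {b j xs} → Partition b xs → b < j → count j xs ≡ 0
count-Partition-> [] _ = refl
count-Partition-> {xs = x ∷ xs} (cons _ x≤b p) b<j =
  trans (count-reject xs (λ j≤x → <⇒≱ b<j (≤-trans j≤x x≤b))) (count-Partition-> p (≤-<-trans x≤b b<j))

applyUpTo-+ : ∀ {A : Set} (f : ℕ → A) m n → applyUpTo f (m + n) ≡ applyUpTo f m ++ applyUpTo (f ∘ (m +_)) n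
applyUpTo-+ f zero n = refl
applyUpTo-+ f (suc m) n = cong (f 0 ∷_) (applyUpTo-+ (f ∘ suc) m n)

applyUpTo-cong : ∀ {A : Set} {f g : ℕ → A} n → (∀ {i} → i < n → f i ≡ g i) → applyUpTo f n ≡ applyUpTo g n
applyUpTo-cong zero f≡g = refl
applyUpTo-cong (suc n) f≡g = cong₂ _∷_ (f≡g (s≤s z≤n)) (applyUpTo-cong n (f≡g ∘ s≤s))

applyUpTo-replicate : ∀ {A : Set} {f : ℕ → A} {c} n → (∀ i → f i ≡ c) → applyUpTo f n ≡ replicate n c
applyUpTo-replicate zero f≡c = refl
applyUpTo-replicate (suc n) f≡c = cong₂ _∷_ (f≡c 0) (applyUpTo-replicate n (f≡c ∘ suc))

pad : List ℕ → ℕ → List ℕ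
pad xs k = xs ++ replicate (k ∸ length xs) 0

length-pad : ∀ {xs k} → length xs ≤ k → length (pad xs k) ≡ k
length-pad {xs} {k} ≤k = trans (length-++ xs) (trans (cong (length xs +_) (length-replicate (k ∸ length xs))) (m+[n∸m]≡n ≤k))

length-conjugate : ∀ b xs → length (conjugate (b ∷ xs)) ≡ b
length-conjugate b xs = trans (length-map _ (1to b)) (length-applyUpTo suc b)

conjugate-padded : ∀ {k ν} → Partition k ν → applyUpTo (λ i → count (suc i) ν) k ≡ pad (conjugate ν) k
conjugate-padded {k} [] = applyUpTo-replicate k (λ _ → refl)
conjugate-padded {k} {ν@(b ∷ xs)} (cons 1≤b b≤k q) = begin
  applyUpTo g k                                  ≡⟨ cong (applyUpTo g) (sym (m+[n∸m]≡n b≤k)) ⟩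
  applyUpTo g (b + (k ∸ b))                      ≡⟨ applyUpTo-+ g b (k ∸ b) ⟩
  applyUpTo g b ++ applyUpTo (g ∘ (b +_)) (k ∸ b) ≡⟨ cong₂ _++_ (sym (map-applyUpTo suc (λ j → count j ν) b))
                                                          (applyUpTo-replicate (k ∸ b) beyond-b) ⟩
  conjugate ν ++ replicate (k ∸ b) 0             ≡⟨ cong (λ l → conjugate ν ++ replicate (k ∸ l) 0)
                                                          (sym (length-conjugate b xs)) ⟩
  pad (conjugate ν) k                            ∎
  where
    g : ℕ → ℕ
    g i = count (suc i) ν
    beyond-b : ∀ i → g (b + i) ≡ 0
    beyond-b i = count-Partition-> (cons 1≤b ≤-refl q) (s≤s (m≤m+n b i))

-- A hook of length 2c + 1 (arm and leg of length c) wrapped around a diagram ν inside the c × c box.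
addHook : ℕ → List ℕ → List ℕ
addHook c ν = suc c ∷ map suc (pad ν c)

conjugate-addHook : ∀ {c ν} → Partition c ν → length ν ≤ c → conjugate (addHook c ν) ≡ addHook c (conjugate ν)
conjugate-addHook {c} {ν} p ≤c = cong₂ _∷_ arm leg
  where
    g : ℕ → ℕ
    g j = count j (addHook c ν)
    arm : g 1 ≡ suc c
    arm = begin
      g 1                         ≡⟨ count-accept {x = suc c} (map suc (pad ν c)) (s≤s z≤n) ⟩
      suc (count 1 (map suc (pad ν c))) ≡⟨ cong suc (count-map-suc 0 (pad ν c)) ⟩
      suc (count 0 (pad ν c))     ≡⟨ cong suc (count-zero (pad ν c)) ⟩
      suc (length (pad ν c))      ≡⟨ cong suc (length-pad {ν} ≤c) ⟩
      suc c                       ∎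
    leg-entry : ∀ {i} → i < c → g (suc (suc i)) ≡ suc (count (suc i) ν)
    leg-entry {i} i<c = begin
      g (suc (suc i))                         ≡⟨ count-accept (map suc (pad ν c)) (s≤s i<c) ⟩
      suc (count (suc (suc i)) (map suc (pad ν c))) ≡⟨ cong suc (count-map-suc (suc i) (pad ν c)) ⟩
      suc (count (suc i) (pad ν c))           ≡⟨ cong suc (count-++-zeros i ν (c ∸ length ν)) ⟩
      suc (count (suc i) ν)                   ∎
    leg : map g (applyUpTo (suc ∘ suc) c) ≡ map suc (pad (conjugate ν) c)
    leg = begin
      map g (applyUpTo (suc ∘ suc) c)              ≡⟨ map-applyUpTo (suc ∘ suc) g c ⟩
      applyUpTo (g ∘ suc ∘ suc) c                  ≡⟨ applyUpTo-cong c leg-entry ⟩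
      applyUpTo (λ i → suc (count (suc i) ν)) c    ≡⟨ map-applyUpTo (λ i → count (suc i) ν) suc c ⟨
      map suc (applyUpTo (λ i → count (suc i) ν) c) ≡⟨ cong (map suc) (conjugate-padded p) ⟩
      map suc (pad (conjugate ν) c)                ∎

stripColumn : List ℕ → List ℕ
stripColumn (suc (suc k) ∷ xs) = suc k ∷ stripColumn xs
stripColumn _ = []

stripColumn-Partition : ∀ {k xs} → Partition (suc k) xs → Partition k (stripColumn xs)
stripColumn-Partition [] = []
stripColumn-Partition (cons {k = suc zero} _ _ _) = []
stripColumn-Partition (cons {k = suc (suc _)} _ (s≤s x≤k) p) = cons (s≤s z≤n) x≤k (stripColumn-Partition p)

length-stripColumn : ∀ xs → length (stripColumn xs) ≤ length xs
length-stripColumn (suc (suc _) ∷ xs) = s≤s (length-stripColumn xs)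
length-stripColumn [] = z≤n
length-stripColumn (zero ∷ _) = z≤n
length-stripColumn (suc zero ∷ _) = z≤n

stripColumn-ones : ∀ {xs} → Partition 1 xs → stripColumn xs ≡ []
stripColumn-ones [] = refl
stripColumn-ones (cons {k = suc zero} _ _ _) = refl
stripColumn-ones (cons {k = suc (suc _)} _ (s≤s ()) _)

Partition-stripColumn : ∀ {m xs} → Partition m xs → xs ≡ map suc (pad (stripColumn xs) (length xs))
Partition-stripColumn [] = refl
Partition-stripColumn {xs = suc zero ∷ xs} (cons _ _ p) =
  cong (1 ∷_) (trans (Partition-stripColumn p) (cong (λ l → map suc (pad l (length xs))) (stripColumn-ones p)))
Partition-stripColumn {xs = suc (suc _) ∷ _} (cons _ _ p) = cong (_ ∷_) (Partition-stripColumn p)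

stripColumn-shift : ∀ {xs} r → All (1 ≤_) xs → stripColumn (map suc (xs ++ replicate r 0)) ≡ xs
stripColumn-shift zero [] = refl
stripColumn-shift (suc r) [] = refl
stripColumn-shift r (s≤s {n = x} _ ∷ pos) = cong (suc x ∷_) (stripColumn-shift r pos)

addHook-injective : ∀ {c xs ys} → All (1 ≤_) xs → All (1 ≤_) ys → addHook c xs ≡ addHook c ys → xs ≡ ys
addHook-injective {c} {xs} {ys} xs-pos ys-pos eq = begin
  xs                                          ≡⟨ stripColumn-shift (c ∸ length xs) xs-pos ⟨
  stripColumn (map suc (pad xs c))            ≡⟨ cong stripColumn (∷-injectiveʳ eq) ⟩
  stripColumn (map suc (pad ys c))            ≡⟨ stripColumn-shift (c ∸ length ys) ys-pos ⟩
  ys                                          ∎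

Partition-positive : ∀ {m xs} → Partition m xs → All (1 ≤_) xs
Partition-positive [] = []
Partition-positive (cons 1≤x _ p) = 1≤x ∷ Partition-positive p

conjugate-positive : ∀ xs → All (1 ≤_) (conjugate xs)
conjugate-positive [] = []
conjugate-positive (b ∷ xs) =
  All.map⁺ (All.applyUpTo⁺₁ suc b (λ {i} i<b → subst (1 ≤_) (sym (count-accept {x = b} xs i<b)) (s≤s z≤n)))

-- The diagonal-hook decomposition of a self-conjugate partition with parts at most k.
data NestedHooks : ℕ → List ℕ → Set where
  [] : ∀ {k} → NestedHooks k []
  wrap : ∀ {k c ν} → c < k → NestedHooks c ν → NestedHooks k (addHook c ν)

Partition-shift : ∀ {c xs} r → Partition c xs → Partition (suc c) (map suc (xs ++ replicate r 0))
Partition-shift zero [] = []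
Partition-shift (suc r) [] = cons (s≤s z≤n) (s≤s z≤n) (Partition-shift r [])
Partition-shift r (cons _ x≤c p) = cons (s≤s z≤n) (s≤s x≤c) (Partition-shift r p)

NestedHooks-length : ∀ {k μ} → NestedHooks k μ → length μ ≤ k
NestedHooks-length [] = z≤n
NestedHooks-length {k} (wrap {ν = ν} c<k h) =
  subst (_≤ k) (cong suc (sym (trans (length-map suc (pad ν _)) (length-pad {ν} (NestedHooks-length h))))) c<k

NestedHooks-Partition : ∀ {k μ} → NestedHooks k μ → Partition k μ
NestedHooks-Partition [] = []
NestedHooks-Partition (wrap c<k h) = cons (s≤s z≤n) c<k (Partition-shift _ (NestedHooks-Partition h))

NestedHooks-selfConjugate : ∀ {k μ} → NestedHooks k μ → conjugate μ ≡ μ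
NestedHooks-selfConjugate [] = refl
NestedHooks-selfConjugate (wrap {c = c} _ h) =
  trans (conjugate-addHook (NestedHooks-Partition h) (NestedHooks-length h))
        (cong (addHook c) (NestedHooks-selfConjugate h))

length-tail-selfConjugate : ∀ {m c rest} → Partition m (suc c ∷ rest) → conjugate (suc c ∷ rest) ≡ suc c ∷ rest →
  length rest ≡ c
length-tail-selfConjugate {c = c} {rest} (cons _ _ p) self = suc-injective (begin
  suc (length rest)          ≡⟨ cong suc (count-Partition-1 p) ⟨
  suc (count 1 rest)         ≡⟨ count-accept {x = suc c} rest (s≤s z≤n) ⟨
  count 1 (suc c ∷ rest)     ≡⟨ ∷-injectiveˡ self ⟩
  suc c                      ∎)

selfConjugate⇒NestedHooks : ∀ {k μ} → Partition k μ → conjugate μ ≡ μ → NestedHooks k μ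
selfConjugate⇒NestedHooks = nested (<-wellFounded _)
  where
    nested : ∀ {k μ} → Acc _<_ k → Partition k μ → conjugate μ ≡ μ → NestedHooks k μ
    nested _ [] _ = []
    nested _ (cons {k = zero} () _ _) _
    nested (acc rec) p@(cons {k = suc c} {xs = rest} _ c<k q) self =
      subst (NestedHooks _) (sym μ≡addHook) (wrap c<k (nested (rec c<k) ν-partition ν-self))
      where
        ν : List ℕ
        ν = stripColumn rest
        ν-partition : Partition c ν
        ν-partition = stripColumn-Partition q
        ν-length : length ν ≤ c
        ν-length = ≤-trans (length-stripColumn rest) (≤-reflexive (length-tail-selfConjugate p self))
        μ≡addHook : suc c ∷ rest ≡ addHook c ν
        μ≡addHook = cong (suc c ∷_) (begin
          rest                                   ≡⟨ Partition-stripColumn q ⟩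
          map suc (pad ν (length rest))          ≡⟨ cong (map suc ∘ pad ν) (length-tail-selfConjugate p self) ⟩
          map suc (pad ν c)                      ∎)
        ν-self : conjugate ν ≡ ν
        ν-self = addHook-injective (conjugate-positive ν) (Partition-positive ν-partition) (begin
          addHook c (conjugate ν)   ≡⟨ conjugate-addHook ν-partition ν-length ⟨
          conjugate (addHook c ν)   ≡⟨ cong conjugate μ≡addHook ⟨
          conjugate (suc c ∷ rest)  ≡⟨ self ⟩
          suc c ∷ rest              ≡⟨ μ≡addHook ⟩
          addHook c ν               ∎)

sum-map-suc : ∀ xs → sum (map suc xs) ≡ length xs + sum xs
sum-map-suc [] = refl
sum-map-suc (x ∷ xs) = cong suc (begin
  x + sum (map suc xs)        ≡⟨ cong (x +_) (sum-map-suc xs) ⟩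
  x + (length xs + sum xs)    ≡⟨ +-assoc x (length xs) (sum xs) ⟨
  (x + length xs) + sum xs    ≡⟨ cong (_+ sum xs) (+-comm x (length xs)) ⟩
  (length xs + x) + sum xs    ≡⟨ +-assoc (length xs) x (sum xs) ⟩
  length xs + (x + sum xs)    ∎)

sum-replicate-zero : ∀ r → sum (replicate r 0) ≡ 0
sum-replicate-zero zero = refl
sum-replicate-zero (suc r) = sum-replicate-zero r

sum-addHook : ∀ {c ν} → length ν ≤ c → sum (addHook c ν) ≡ suc (c + c) + sum ν
sum-addHook {c} {ν} ≤c = cong suc (begin
  c + sum (map suc (pad ν c))            ≡⟨ cong (c +_) (sum-map-suc (pad ν c)) ⟩
  c + (length (pad ν c) + sum (pad ν c)) ≡⟨ cong₂ (λ l s → c + (l + s)) (length-pad {ν} ≤c) sum-pad ⟩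
  c + (c + sum ν)                        ≡⟨ +-assoc c c (sum ν) ⟨
  c + c + sum ν                          ∎)
  where
    sum-pad : sum (pad ν c) ≡ sum ν
    sum-pad = trans (sum-++ ν (replicate _ 0))
                    (trans (cong (sum ν +_) (sum-replicate-zero (c ∸ length ν))) (+-identityʳ (sum ν)))

-- For self-conjugate μ, where μᵢ = μ′ᵢ, the i-th diagonal hook has length 2(μᵢ − i) + 1.
diagonalHooks : ℕ → List ℕ → List ℕ
diagonalHooks i [] = []
diagonalHooks i (p ∷ ps) = if i ≤ᵇ p then suc ((p ∸ i) + (p ∸ i)) ∷ diagonalHooks (suc i) ps else []

hooks : List ℕ → List ℕ
hooks = diagonalHooks 1

diagonalHooks-map-suc : ∀ i xs → diagonalHooks (2 + i) (map suc xs) ≡ diagonalHooks (1 + i) xs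
diagonalHooks-map-suc i [] = refl
diagonalHooks-map-suc i (p ∷ ps) =
  cong (λ t → if suc i ≤ᵇ p then _ ∷ t else []) (diagonalHooks-map-suc (suc i) ps)

diagonalHooks-++-zeros : ∀ i xs r → diagonalHooks (1 + i) (xs ++ replicate r 0) ≡ diagonalHooks (1 + i) xs
diagonalHooks-++-zeros i [] zero = refl
diagonalHooks-++-zeros i [] (suc r) = refl
diagonalHooks-++-zeros i (p ∷ ps) r =
  cong (λ t → if suc i ≤ᵇ p then _ ∷ t else []) (diagonalHooks-++-zeros (suc i) ps r)

hooks-addHook : ∀ c ν → hooks (addHook c ν) ≡ suc (c + c) ∷ hooks ν
hooks-addHook c ν =
  cong (suc (c + c) ∷_) (trans (diagonalHooks-map-suc 0 (pad ν c)) (diagonalHooks-++-zeros 0 ν (c ∸ length ν)))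

unhook : List ℕ → List ℕ
unhook [] = []
unhook (h ∷ hs) = addHook ⌊ h /2⌋ (unhook hs)

⌊1+n+n/2⌋≡n : ∀ n → ⌊ suc (n + n) /2⌋ ≡ n
⌊1+n+n/2⌋≡n zero = refl
⌊1+n+n/2⌋≡n (suc n) rewrite +-suc n n = cong suc (⌊1+n+n/2⌋≡n n)

unhook-∷ : ∀ c hs → unhook (suc (c + c) ∷ hs) ≡ addHook c (unhook hs)
unhook-∷ c hs = cong (λ k → addHook k (unhook hs)) (⌊1+n+n/2⌋≡n c)

Even : ℕ → Set
Even p = p % 2 ≡ 0

data Odd : ℕ → Set where
  odd : ∀ c → Odd (suc (c + c))

odd⇒¬Even : ∀ {p} → Odd p → ¬ Even p
odd⇒¬Even (odd c) = 1≢0 c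
  where
    1≢0 : ∀ c → ¬ suc (c + c) % 2 ≡ 0
    1≢0 zero ()
    1≢0 (suc c) rewrite +-suc c c = 1≢0 c

¬Even⇒Odd : ∀ p → ¬ Even p → Odd p
¬Even⇒Odd zero ¬even = ⊥-elim (¬even refl)
¬Even⇒Odd (suc zero) _ = odd 0
¬Even⇒Odd (suc (suc p)) ¬even with ¬Even⇒Odd p ¬even
... | odd c = subst Odd (cong (suc ∘ suc) (+-suc c c)) (odd (suc c))

double-<⇒< : ∀ {c k} → c + c < k + k → c < k
double-<⇒< {c} {k} lt with c <? k
... | yes c<k = c<k
... | no c≮k = ⊥-elim (<⇒≱ lt (+-mono-≤ (≮⇒≥ c≮k) (≮⇒≥ c≮k)))

hooks-Distinct : ∀ {k μ} → NestedHooks k μ → Distinct (suc (k + k)) (hooks μ)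
hooks-Distinct [] = []
hooks-Distinct (wrap {c = c} {ν} c<k h) rewrite hooks-addHook c ν =
  cons (s≤s z≤n) (s≤s (+-mono-< c<k c<k)) (hooks-Distinct h)

hooks-odd : ∀ {k μ} → NestedHooks k μ → All Odd (hooks μ)
hooks-odd [] = []
hooks-odd (wrap {c = c} {ν} _ h) rewrite hooks-addHook c ν = odd c ∷ hooks-odd h

unhook-hooks : ∀ {k μ} → NestedHooks k μ → unhook (hooks μ) ≡ μ
unhook-hooks [] = refl
unhook-hooks (wrap {c = c} {ν} _ h) = begin
  unhook (hooks (addHook c ν))       ≡⟨ cong unhook (hooks-addHook c ν) ⟩
  unhook (suc (c + c) ∷ hooks ν)     ≡⟨ unhook-∷ c (hooks ν) ⟩
  addHook c (unhook (hooks ν))       ≡⟨ cong (addHook c) (unhook-hooks h) ⟩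
  addHook c ν                        ∎

sum-hooks : ∀ {k μ} → NestedHooks k μ → sum (hooks μ) ≡ sum μ
sum-hooks [] = refl
sum-hooks (wrap {c = c} {ν} _ h) = begin
  sum (hooks (addHook c ν))          ≡⟨ cong sum (hooks-addHook c ν) ⟩
  suc (c + c) + sum (hooks ν)        ≡⟨ cong (suc (c + c) +_) (sum-hooks h) ⟩
  suc (c + c) + sum ν                ≡⟨ sum-addHook {ν = ν} (NestedHooks-length h) ⟨
  sum (addHook c ν)                  ∎

unhook-NestedHooks : ∀ {k hs} → Distinct (suc (k + k)) hs → All Odd hs → NestedHooks k (unhook hs)
unhook-NestedHooks [] [] = []
unhook-NestedHooks {hs = _ ∷ hs} (cons _ (s≤s 2c<2k) d) (odd c ∷ os) =
  subst (NestedHooks _) (sym (unhook-∷ c hs)) (wrap (double-<⇒< 2c<2k) (unhook-NestedHooks d os))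

hooks-unhook : ∀ {hs} → All Odd hs → hooks (unhook hs) ≡ hs
hooks-unhook [] = refl
hooks-unhook {_ ∷ hs} (odd c ∷ os) = begin
  hooks (unhook (suc (c + c) ∷ hs))  ≡⟨ cong hooks (unhook-∷ c hs) ⟩
  hooks (addHook c (unhook hs))      ≡⟨ hooks-addHook c (unhook hs) ⟩
  suc (c + c) ∷ hooks (unhook hs)    ≡⟨ cong (suc (c + c) ∷_) (hooks-unhook os) ⟩
  suc (c + c) ∷ hs                   ∎

Distinct-weaken : ∀ {m n xs} → m ≤ n → Distinct m xs → Distinct n xs
Distinct-weaken _ [] = []
Distinct-weaken m≤n (cons 1≤x x<m d) = cons 1≤x (<-≤-trans x<m m≤n) d

Distinct-filter : ∀ {P : Pred ℕ 0ℓ} (P? : U.Decidable P) {m xs} → Distinct m xs → Distinct m (filter P? xs)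
Distinct-filter P? [] = []
Distinct-filter P? {xs = x ∷ xs} (cons 1≤x x<m d) with does (P? x)
... | true = cons 1≤x x<m (Distinct-filter P? d)
... | false = Distinct-weaken (<⇒≤ x<m) (Distinct-filter P? d)

-- The decision procedure for _>_ is a parameter: for the concrete _>?_, does (x >? y) unfolds to y <ᵇ x,
-- which `with x >? y` can no longer abstract.
module _ (_>?′_ : Decidable _>_) {P : Pred ℕ 0ℓ} where

  merge-Distinct : ∀ {m xs ys} → Distinct m xs → Distinct m ys → All P xs → All (∁ P) ys →
    Distinct m (merge _>?′_ xs ys)
  merge-Distinct [] dys _ _ = dys
  merge-Distinct {xs = x ∷ xs} (cons 1≤x x<m dxs) dys (px ∷ pxs) ¬pys = go x<m dys ¬pys
    where
      go : ∀ {n ys} → x < n → Distinct n ys → All (∁ P) ys → Distinct n (merge _>?′_ (x ∷ xs) ys)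
      go x<n [] _ = cons 1≤x x<n dxs
      go {ys = y ∷ ys} x<n (cons 1≤y y<n dys) (¬py ∷ ¬pys) with x >?′ y
      ... | yes y<x = cons 1≤x x<n (merge-Distinct dxs (cons 1≤y y<x dys) pxs (¬py ∷ ¬pys))
      ... | no x≯y = cons 1≤y y<n (go (≤∧≢⇒< (≮⇒≥ x≯y) (λ x≡y → ¬py (subst P x≡y px))) dys ¬pys)

  module _ (P? : U.Decidable P) where

    filter-merge : ∀ {xs ys} → All P xs → All (∁ P) ys → filter P? (merge _>?′_ xs ys) ≡ xs
    filter-merge [] ¬pys = filter-none P? ¬pys
    filter-merge {x ∷ xs} pxs@(px ∷ pxs′) = go
      where
        go : ∀ {ys} → All (∁ P) ys → filter P? (merge _>?′_ (x ∷ xs) ys) ≡ x ∷ xs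
        go [] = filter-all P? pxs
        go {y ∷ ys} (¬py ∷ ¬pys) with x >?′ y
        ... | yes _ = trans (filter-accept P? px) (cong (x ∷_) (filter-merge pxs′ (¬py ∷ ¬pys)))
        ... | no _ = trans (filter-reject P? ¬py) (go ¬pys)

    filter-∁-merge : ∀ {xs ys} → All P xs → All (∁ P) ys → filter (∁? P?) (merge _>?′_ xs ys) ≡ ys
    filter-∁-merge [] ¬pys = filter-all (∁? P?) ¬pys
    filter-∁-merge {x ∷ xs} pxs@(px ∷ pxs′) = go
      where
        go : ∀ {ys} → All (∁ P) ys → filter (∁? P?) (merge _>?′_ (x ∷ xs) ys) ≡ ys
        go [] = filter-none (∁? P?) (All.map (λ px ¬px → ¬px px) pxs)
        go {y ∷ ys} (¬py ∷ ¬pys) with x >?′ y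
        ... | yes _ = trans (filter-reject (∁? P?) (λ ¬px → ¬px px)) (filter-∁-merge pxs′ (¬py ∷ ¬pys))
        ... | no _ = trans (filter-accept (∁? P?) ¬py) (cong (y ∷_) (go ¬pys))

    merge-filter : ∀ {m d} → Distinct m d → merge _>?′_ (filter P? d) (filter (∁? P?) d) ≡ d
    merge-filter [] = refl
    merge-filter {d = x ∷ xs} (cons _ _ dxs) with P? x
    ... | yes _ = merge-∷ˡ (filter P? xs) (Distinct-filter (∁? P?) dxs) (merge-filter dxs)
      where
        merge-∷ˡ : ∀ F {G} → Distinct x G → merge _>?′_ F G ≡ xs → merge _>?′_ (x ∷ F) G ≡ x ∷ xs
        merge-∷ˡ [] [] eq = cong (x ∷_) eq
        merge-∷ˡ (_ ∷ _) [] eq = cong (x ∷_) eq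
        merge-∷ˡ F {g ∷ _} (cons _ g<x _) eq with x >?′ g
        ... | yes _ = cong (x ∷_) eq
        ... | no x≯g = ⊥-elim (x≯g g<x)
    ... | no _ = merge-∷ʳ (filter (∁? P?) xs) (Distinct-filter P? dxs) (merge-filter dxs)
      where
        merge-∷ʳ : ∀ G {F} → Distinct x F → merge _>?′_ F G ≡ xs → merge _>?′_ F (x ∷ G) ≡ x ∷ xs
        merge-∷ʳ G [] eq = cong (x ∷_) eq
        merge-∷ʳ G {f ∷ _} (cons _ f<x _) eq with f >?′ x
        ... | yes x<f = ⊥-elim (<-asym x<f f<x)
        ... | no _ = cong (x ∷_) eq

sum-merge : ∀ {R : Rel ℕ 0ℓ} (R? : Decidable R) xs ys → sum (merge R? xs ys) ≡ sum xs + sum ys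
sum-merge R? xs ys = trans (sum-↭ (merge-↭ R? xs ys)) (sum-++ xs ys)

Distinct-sum : ∀ {m xs} → Distinct m xs → Distinct (suc (sum xs)) xs
Distinct-sum [] = []
Distinct-sum {xs = x ∷ xs} (cons 1≤x _ d) = cons 1≤x (s≤s (m≤m+n x (sum xs))) d

partitions-unique : ∀ a → Unique (partitions a)
partitions-unique a = subst Unique (sym (partsFuel≡descending a a a)) (descending-unique _≤?_ a a a)

∈-partitions⁻ : ∀ {a μ} → μ ∈ partitions a → Partition a μ × sum μ ≡ a
∈-partitions⁻ {a} {μ} μ∈ = ∈-descending⁻ _≤?_ (subst (μ ∈_) (partsFuel≡descending a a a) μ∈)

∈-partitions⁺ : ∀ {a μ} → Partition a μ → sum μ ≡ a → μ ∈ partitions a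
∈-partitions⁺ {a} {μ} p sum≡ = subst (μ ∈_) (sym (partsFuel≡descending a a a)) (∈-descending⁺ _≤?_ ≤-refl p sum≡)

distinctPartitions-unique : ∀ n → Unique (distinctPartitions n)
distinctPartitions-unique n = subst Unique (sym (distFuel≡descending n n (suc n))) (descending-unique _<?_ n n (suc n))

∈-distinctPartitions⁻ : ∀ {n d} → d ∈ distinctPartitions n → Distinct (suc n) d × sum d ≡ n
∈-distinctPartitions⁻ {n} {d} d∈ = ∈-descending⁻ _<?_ (subst (d ∈_) (distFuel≡descending n n (suc n)) d∈)

∈-distinctPartitions⁺ : ∀ {n d} → Distinct (suc n) d → sum d ≡ n → d ∈ distinctPartitions n
∈-distinctPartitions⁺ {n} {d} dist sum≡ =
  subst (d ∈_) (sym (distFuel≡descending n n (suc n))) (∈-descending⁺ _<?_ ≤-refl dist sum≡)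

even? : U.Decidable Even
even? p = p % 2 ≟ 0

allEven? : (ν : List ℕ) → Dec (length (filter even? ν) ≡ length ν)
allEven? ν = length (filter even? ν) ≟ length ν

∈-distinctEvenPartitions⁻ : ∀ {m ν} → ν ∈ distinctEvenPartitions m → Distinct (suc m) ν × sum ν ≡ m × All Even ν
∈-distinctEvenPartitions⁻ {m} {ν} ν∈
  with ν∈′ , all-even ← ∈-filter⁻ allEven? {xs = distinctPartitions m} ν∈
  with dist , sum≡ ← ∈-distinctPartitions⁻ ν∈′ =
  dist , sum≡ , subst (All Even) (filter-complete even? all-even) (All.all-filter even? ν)

∈-distinctEvenPartitions⁺ : ∀ {m ν} → Distinct (suc m) ν → sum ν ≡ m → All Even ν → ν ∈ distinctEvenPartitions m
∈-distinctEvenPartitions⁺ dist sum≡ evens =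
  ∈-filter⁺ allEven? (∈-distinctPartitions⁺ dist sum≡) (cong length (filter-all even? evens))

record SelfHalfConjugateD₂ (n : ℕ) (μ ν : List ℕ) : Set where
  field
    partition : Partition (sum μ) μ
    self-conjugate : conjugate μ ≡ μ
    distinct : Distinct (suc (sum ν)) ν
    even : All Even ν
    size : sum μ + sum ν ≡ n

selfConjugate? : (μ : List ℕ) → Dec (conjugate μ ≡ μ)
selfConjugate? μ = ≡-dec _≟_ (conjugate μ) μ

withNonOverlinedSum : ℕ → ℕ → List (List ℕ × List ℕ)
withNonOverlinedSum n a =
  concatMap (λ μ → map (μ ,_) (distinctEvenPartitions (n ∸ a))) (filter selfConjugate? (partitions a))

∈-withNonOverlinedSum⁻ : ∀ {n a μ ν} → a ≤ n → (μ , ν) ∈ withNonOverlinedSum n a → sum μ ≡ a × SelfHalfConjugateD₂ n μ ν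
∈-withNonOverlinedSum⁻ {n} {a} {μ} {ν} a≤n μν∈
  with μ′ , μ′∈ , μν∈′ ← find (∈-concatMap⁻ (λ μ → map (μ ,_) (distinctEvenPartitions (n ∸ a)))
                                             {xs = filter selfConjugate? (partitions a)} μν∈)
  with _ , ν∈ , refl ← ∈-map⁻ (μ′ ,_) μν∈′
  with μ∈ , self ← ∈-filter⁻ selfConjugate? {xs = partitions a} μ′∈
  with part , sum-μ ← ∈-partitions⁻ {a} μ∈
  with dist , sum-ν , evens ← ∈-distinctEvenPartitions⁻ ν∈ = sum-μ , record
  { partition = subst (λ b → Partition b μ) (sym sum-μ) part
  ; self-conjugate = self
  ; distinct = Distinct-sum dist
  ; even = evens
  ; size = trans (cong₂ _+_ sum-μ sum-ν) (m+[n∸m]≡n a≤n)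
  }

∈-selfHalfConjugateD₂⁻ : ∀ {n μ ν} → (μ , ν) ∈ selfHalfConjugateD₂ n → SelfHalfConjugateD₂ n μ ν
∈-selfHalfConjugateD₂⁻ {n} μν∈
  with a , a∈ , μν∈′ ← find (∈-concatMap⁻ (withNonOverlinedSum n) {xs = upTo (suc n)} μν∈) =
  proj₂ (∈-withNonOverlinedSum⁻ (s≤s⁻¹ (∈-upTo⁻ a∈)) μν∈′)

∈-selfHalfConjugateD₂⁺ : ∀ {n μ ν} → SelfHalfConjugateD₂ n μ ν → (μ , ν) ∈ selfHalfConjugateD₂ n
∈-selfHalfConjugateD₂⁺ {n} {μ} {ν} s =
  ∈-concatMap⁺ (withNonOverlinedSum n) (lose (∈-upTo⁺ (s≤s sum-μ≤n))
    (∈-concatMap⁺ (λ μ′ → map (μ′ ,_) (distinctEvenPartitions (n ∸ sum μ)))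
      (lose (∈-filter⁺ selfConjugate? (∈-partitions⁺ partition refl) self-conjugate)
        (∈-map⁺ (μ ,_) (∈-distinctEvenPartitions⁺ (subst (λ s → Distinct (suc s) ν) sum-ν distinct) sum-ν even)))))
  where
    open SelfHalfConjugateD₂ s
    sum-μ≤n : sum μ ≤ n
    sum-μ≤n = subst (sum μ ≤_) size (m≤m+n (sum μ) (sum ν))
    sum-ν : sum ν ≡ n ∸ sum μ
    sum-ν = trans (sym (m+n∸m≡n (sum μ) (sum ν))) (cong (_∸ sum μ) size)

selfHalfConjugateD₂-unique : ∀ n → Unique (selfHalfConjugateD₂ n)
selfHalfConjugateD₂-unique n = concatMap-unique (sum ∘ proj₁) (upTo⁺ (suc n))
  (λ a → concatMap-unique proj₁ (filter⁺ selfConjugate? (partitions-unique a))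
    (λ μ → map⁺ (cong proj₂) (filter⁺ allEven? (distinctPartitions-unique (n ∸ a))))
    (λ {μ} _ μν∈ → cong proj₁ (proj₂ (proj₂ (∈-map⁻ (μ ,_) μν∈)))))
  (λ a∈ μν∈ → proj₁ (∈-withNonOverlinedSum⁻ (s≤s⁻¹ (∈-upTo⁻ a∈)) μν∈))

toDistinct : List ℕ × List ℕ → List ℕ
toDistinct (μ , ν) = merge _>?_ ν (hooks μ)

fromDistinct : List ℕ → List ℕ × List ℕ
fromDistinct d = unhook (filter (∁? even?) d) , filter even? d

module _ {n μ ν} (s : SelfHalfConjugateD₂ n μ ν) where
  open SelfHalfConjugateD₂ s

  private
    nested : NestedHooks (sum μ) μ
    nested = selfConjugate⇒NestedHooks partition self-conjugate

    hooks-notEven : All (∁ Even) (hooks μ)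
    hooks-notEven = All.map odd⇒¬Even (hooks-odd nested)

  toDistinct-∈ : toDistinct (μ , ν) ∈ distinctPartitions n
  toDistinct-∈ = ∈-distinctPartitions⁺
    (merge-Distinct _>?_ (Distinct-weaken (s≤s sum-ν≤n) distinct) (Distinct-weaken (s≤s sum-μ≤n) hooks-distinct)
                    even hooks-notEven)
    (begin
      sum (merge _>?_ ν (hooks μ))  ≡⟨ sum-merge _>?_ ν (hooks μ) ⟩
      sum ν + sum (hooks μ)         ≡⟨ cong (sum ν +_) (sum-hooks nested) ⟩
      sum ν + sum μ                 ≡⟨ +-comm (sum ν) (sum μ) ⟩
      sum μ + sum ν                 ≡⟨ size ⟩
      n                             ∎)
    where
      sum-μ≤n : sum μ ≤ n
      sum-μ≤n = subst (sum μ ≤_) size (m≤m+n (sum μ) (sum ν))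
      sum-ν≤n : sum ν ≤ n
      sum-ν≤n = subst (sum ν ≤_) size (m≤n+m (sum ν) (sum μ))
      hooks-distinct : Distinct (suc (sum μ)) (hooks μ)
      hooks-distinct = subst (λ s → Distinct (suc s) (hooks μ)) (sum-hooks nested) (Distinct-sum (hooks-Distinct nested))

  fromDistinct-toDistinct : fromDistinct (toDistinct (μ , ν)) ≡ (μ , ν)
  fromDistinct-toDistinct = cong₂ _,_
    (trans (cong unhook (filter-∁-merge _>?_ even? even hooks-notEven)) (unhook-hooks nested))
    (filter-merge _>?_ even? even hooks-notEven)

module _ {n d} (d∈ : d ∈ distinctPartitions n) where

  private
    dist : Distinct (suc n) d
    dist = proj₁ (∈-distinctPartitions⁻ d∈)

    odds : List ℕ
    odds = filter (∁? even?) d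

    odds-odd : All Odd odds
    odds-odd = All.map (¬Even⇒Odd _) (All.all-filter (∁? even?) d)

    nested : NestedHooks (sum odds) (unhook odds)
    nested = unhook-NestedHooks
      (Distinct-weaken (s≤s (m≤m+n (sum odds) (sum odds))) (Distinct-sum (Distinct-filter (∁? even?) dist))) odds-odd

  toDistinct-fromDistinct : toDistinct (fromDistinct d) ≡ d
  toDistinct-fromDistinct =
    trans (cong (merge _>?_ (filter even? d)) (hooks-unhook odds-odd)) (merge-filter _>?_ even? dist)

  fromDistinct-selfHalfConjugate : SelfHalfConjugateD₂ n (unhook odds) (filter even? d)
  fromDistinct-selfHalfConjugate = record
    { partition = subst (λ s → Partition s (unhook odds)) (sym sum-unhook) (NestedHooks-Partition nested)
    ; self-conjugate = NestedHooks-selfConjugate nested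
    ; distinct = Distinct-sum (Distinct-filter even? dist)
    ; even = All.all-filter even? d
    ; size = begin
        sum (unhook odds) + sum (filter even? d)      ≡⟨ cong (_+ sum (filter even? d)) sum-unhook ⟩
        sum odds + sum (filter even? d)               ≡⟨ +-comm (sum odds) (sum (filter even? d)) ⟩
        sum (filter even? d) + sum odds               ≡⟨ sum-merge _>?_ (filter even? d) odds ⟨
        sum (merge _>?_ (filter even? d) odds)        ≡⟨ cong sum (merge-filter _>?_ even? dist) ⟩
        sum d                                         ≡⟨ proj₂ (∈-distinctPartitions⁻ d∈) ⟩
        n                                             ∎
    }
    where
      sum-unhook : sum (unhook odds) ≡ sum odds
      sum-unhook = trans (sym (sum-hooks nested)) (cong sum (hooks-unhook odds-odd))

-- The identity holds for n = 0 as well (h 0 = q 0 = 1).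
theorem3 : (n : ℕ) → 1 ≤ n → h n ≡ q n
theorem3 n _ = length-≡-by-inverses (selfHalfConjugateD₂-unique n) (distinctPartitions-unique n)
  toDistinct fromDistinct
  (λ μν∈ → toDistinct-∈ (∈-selfHalfConjugateD₂⁻ {n} μν∈))
  (λ d∈ → ∈-selfHalfConjugateD₂⁺ (fromDistinct-selfHalfConjugate {n} d∈))
  (λ μν∈ → fromDistinct-toDistinct (∈-selfHalfConjugateD₂⁻ {n} μν∈))
  (toDistinct-fromDistinct {n})
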